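{- The subspaces $\mathfrak{E}_2^S$ (totally symmetric elements) and $\mathfrak{E}_2^A$ (totally antisymmetric elements) are subalgebras of $(\mathfrak{E}_2,*)$, and each of them is isomorphic as an algebra to $(\mathfrak{H}^1,*)$.
   Context: $\mathfrak{E}_2$ is the $\mathbb{Q}$-vector space with basis the words (including the empty word $1$) in noncommuting letters $z_{n,p}$, $n\in\{1,2,\dots\}$, $p\in\{0,1\}$, with bilinear product $*$ defined by $w*1=1*w=w$ and $aw_1*bw_2=a(w_1*bw_2)+b(aw_1*w_2)+(a\circ b)(w_1*w_2)$ for letters $a,b$ and words $w_1,w_2$, where $z_{n_1,p_1}\circ z_{n_2,p_2}=z_{n_1+n_2,p_1+p_2}$ with the second index taken mod 2. For $u\in\mathfrak{E}_2$ and a word $w$ let $\mathrm{coeff}_u(w)$ be the coefficient of $w$ in $u$. $u$ is totally symmetric if $\mathrm{coeff}_u(z_{n_1,p_1}\cdots z_{n_k,p_k})=\mathrm{coeff}_u(z_{n_1,0}\cdots z_{n_k,0})$ for all words, and totally antisymmetric if $\mathrm{coeff}_u(z_{n_1,p_1}\cdots z_{n_k,p_k})=(-1)^{p_1+\cdots+p_k}\mathrm{coeff}_u(z_{n_1,0}\cdots z_{n_k,0})$ for all words. $\mathfrak{H}^1$ is the $\mathbb{Q}$-vector space on words in noncommuting letters $z_1,z_2,\dots$ with product $w*1=1*w=w$, $z_iw_1*z_jw_2=z_i(w_1*z_jw_2)+z_j(z_iw_1*w_2)+z_{i+j}(w_1*w_2)$. -}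

module Defs where

open import Data.Nat using (ℕ; zero; suc; _+_)
open import Data.Bool using (Bool; true; false; _xor_)
import Data.Bool.Properties as BoolP
import Data.Nat.Properties as NatP
open import Data.Rational using (ℚ; 0ℚ; 1ℚ; -_) renaming (_+_ to _+q_; _*_ to _*q_)
open import Data.Product using (Σ; _×_; _,_; proj₁; proj₂)
import Data.Product.Properties as ProdP
open import Data.List using (List; []; _∷_; map; _++_; concatMap)
import Data.List.Properties as ListP
open import Relation.Binary.PropositionalEquality using (_≡_)
open import Relation.Nullary using (yes; no)
open import Relation.Binary.Definitions using (DecidableEquality)

-- Generic formal Q-linear combinations of words over an alphabet L
-- (an element is a finite list of (coefficient , word) pairs; two
-- elements are equal when all their coefficients agree).

module FormalSums (L : Set) (_≟L_ : DecidableEquality L) where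

  Word : Set
  Word = List L

  _≟W_ : DecidableEquality Word
  _≟W_ = ListP.≡-dec _≟L_

  Elem : Set
  Elem = List (ℚ × Word)

  coeff : Elem → Word → ℚ
  coeff [] w = 0ℚ
  coeff ((c , v) ∷ u) w with v ≟W w
  ... | yes _ = c +q coeff u w
  ... | no  _ = coeff u w

  _≈_ : Elem → Elem → Set
  u ≈ v = (w : Word) → coeff u w ≡ coeff v w

  ⟦_⟧ : Word → Elem
  ⟦ w ⟧ = (1ℚ , w) ∷ []

  zeroE : Elem
  zeroE = []

  oneE : Elem
  oneE = ⟦ [] ⟧

  _⊕_ : Elem → Elem → Elem
  u ⊕ v = u ++ v

  _·_ : ℚ → Elem → Elem
  c · u = map (λ p → (c *q proj₁ p , proj₂ p)) u

  prefix : L → Elem → Elem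
  prefix a u = map (λ p → (proj₁ p , a ∷ proj₂ p)) u

  module Stuffle (_∘_ : L → L → L) where

    _*w_ : Word → Word → Elem
    [] *w w = ⟦ w ⟧
    (a ∷ w₁) *w [] = ⟦ a ∷ w₁ ⟧
    (a ∷ w₁) *w (b ∷ w₂) =
      prefix a (w₁ *w (b ∷ w₂)) ⊕
      (prefix b ((a ∷ w₁) *w w₂) ⊕ prefix (a ∘ b) (w₁ *w w₂))

    _*_ : Elem → Elem → Elem
    u * v = concatMap (λ p → concatMap (λ q →
              (proj₁ p *q proj₁ q) · (proj₂ p *w proj₂ q)) v) u

-- 𝔈₂ : letters z_{n,p}; the pair (m , p) stands for z_{m+1,p}
-- (p = false ↔ 0, p = true ↔ 1).

LetterE : Set
LetterE = ℕ × Bool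

_≟LE_ : DecidableEquality LetterE
_≟LE_ = ProdP.≡-dec NatP._≟_ BoolP._≟_

-- z_{n₁,p₁} ∘ z_{n₂,p₂} = z_{n₁+n₂, p₁+p₂ mod 2}
_∘E_ : LetterE → LetterE → LetterE
(m₁ , p₁) ∘E (m₂ , p₂) = (suc (m₁ + m₂) , p₁ xor p₂)

module E2 where
  open FormalSums LetterE _≟LE_ public
  open Stuffle _∘E_ public

-- 𝔥¹ : letters z_n; the natural number m stands for z_{m+1}

_∘H_ : ℕ → ℕ → ℕ
m₁ ∘H m₂ = suc (m₁ + m₂)

module H1 where
  open FormalSums ℕ NatP._≟_ public
  open Stuffle _∘H_ public

forgetParity : E2.Word → E2.Word
forgetParity = map (λ l → (proj₁ l , false))

sign : E2.Word → ℚ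
sign [] = 1ℚ
sign ((_ , false) ∷ w) = sign w
sign ((_ , true) ∷ w) = - sign w

TotallySymmetric : E2.Elem → Set
TotallySymmetric u =
  (w : E2.Word) → E2.coeff u w ≡ E2.coeff u (forgetParity w)

TotallyAntisymmetric : E2.Elem → Set
TotallyAntisymmetric u =
  (w : E2.Word) → E2.coeff u w ≡ sign w *q E2.coeff u (forgetParity w)

record IsSubalgebra (P : E2.Elem → Set) : Set where
  field
    respects : ∀ u v → u E2.≈ v → P u → P v
    zero-mem : P E2.zeroE
    add-mem  : ∀ u v → P u → P v → P (u E2.⊕ v)
    smul-mem : ∀ c u → P u → P (c E2.· u)
    one-mem  : P E2.oneE
    mul-mem  : ∀ u v → P u → P v → P (u E2.* v)

record AlgebraIso (P : E2.Elem → Set) : Set where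
  Sub : Set
  Sub = Σ E2.Elem P
  field
    φ : Sub → H1.Elem
    φ-wd    : ∀ (x y : Sub) → proj₁ x E2.≈ proj₁ y → φ x H1.≈ φ y
    φ-add   : ∀ (x y z : Sub) → proj₁ z E2.≈ (proj₁ x E2.⊕ proj₁ y) →
              φ z H1.≈ (φ x H1.⊕ φ y)
    φ-smul  : ∀ (c : ℚ) (x z : Sub) → proj₁ z E2.≈ (c E2.· proj₁ x) →
              φ z H1.≈ (c H1.· φ x)
    φ-one   : ∀ (x : Sub) → proj₁ x E2.≈ E2.oneE → φ x H1.≈ H1.oneE
    φ-mul   : ∀ (x y z : Sub) → proj₁ z E2.≈ (proj₁ x E2.* proj₁ y) →
              φ z H1.≈ (φ x H1.* φ y)
    φ-inj   : ∀ (x y : Sub) → φ x H1.≈ φ y → proj₁ x E2.≈ proj₁ y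
    φ-surj  : ∀ (h : H1.Elem) → Σ Sub (λ x → φ x H1.≈ h)

{-# OPTIONS --safe #-}
module Submission where

-- Both halves are one statement about a character χ of ℤ/2 (χ = 1, resp. χ p = (-1)^p): call u
-- invariant when coeff u w = χ(p₁)⋯χ(pₖ) coeff u (forgetParity w). Taking coefficients turns *
-- into a product ⋆ of functions Word → ℚ, defined by recursion on the first letter. The map
-- sending g : H1.Word → ℚ to w ↦ ∏ᵢ ½χ(pᵢ) · g(n₁⋯nₖ), i.e. z_n ↦ ½(z_{n,0} + χ(1) z_{n,1}),
-- is onto the invariant coefficient functions and is multiplicative for ⋆: a contraction landing
-- on z_{n,p} arises from the parities (0 , p) and (1 , not p), and ½χ(0)·½χ(p) + ½χ(1)·½χ(not p)
-- = ½χ(p). So invariant elements are closed under *, and restricting to parity-free words and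
-- rescaling by 2^length inverts this map, giving the isomorphism with 𝔥¹.

open import Defs
open import Data.Bool using (Bool; true; false; _xor_; not)
open import Data.Bool.Properties using () renaming (_≟_ to _≟𝔹_)
open import Data.Empty using (⊥-elim)
open import Data.List using (List; []; _∷_; map; _++_; concatMap; length)
import Data.List.Properties as ListP
open import Data.Nat using (ℕ; zero; suc; _+_)
import Data.Nat.Properties as NatP
open NatP using () renaming (_≟_ to _≟ℕ_)
open import Data.Product using (Σ; _×_; _,_; proj₁; proj₂; map₁)
open import Data.Rational using (ℚ; 0ℚ; 1ℚ; ½; -_) renaming (_+_ to _+q_; _*_ to _*q_)
import Data.Rational.Properties as ℚP
open import Data.Rational.Solver using (module +-*-Solver)
open import Algebra.Bundles using (CommutativeMonoid)
open import Algebra.Properties.CommutativeSemigroup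
  (CommutativeMonoid.commutativeSemigroup ℚP.*-1-commutativeMonoid) using (x∙yz≈y∙xz)
open import Relation.Binary.Definitions using (DecidableEquality)
open import Relation.Binary.PropositionalEquality
open import Relation.Nullary using (Dec; yes; no; ¬_)
open import Relation.Nullary.Decidable using (_×-dec_)

open +-*-Solver using (solve; _:+_; _:*_; _:=_; con)

sumℚ : List ℚ → ℚ
sumℚ [] = 0ℚ
sumℚ (x ∷ xs) = x +q sumℚ xs

sumℚ-++ : ∀ xs ys → sumℚ (xs ++ ys) ≡ sumℚ xs +q sumℚ ys
sumℚ-++ [] ys = sym (ℚP.+-identityˡ _)
sumℚ-++ (x ∷ xs) ys = trans (cong (x +q_) (sumℚ-++ xs ys)) (sym (ℚP.+-assoc x _ _))

module _ {A : Set} where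

  sumℚ-map-cong : ∀ {f g : A → ℚ} → f ≗ g → ∀ xs →
                  sumℚ (map f xs) ≡ sumℚ (map g xs)
  sumℚ-map-cong f≗g [] = refl
  sumℚ-map-cong f≗g (x ∷ xs) = cong₂ _+q_ (f≗g x) (sumℚ-map-cong f≗g xs)

  sumℚ-map-zero : ∀ {f : A → ℚ} → (∀ x → f x ≡ 0ℚ) → ∀ xs →
                  sumℚ (map f xs) ≡ 0ℚ
  sumℚ-map-zero f≡0 [] = refl
  sumℚ-map-zero f≡0 (x ∷ xs) = cong₂ _+q_ (f≡0 x) (sumℚ-map-zero f≡0 xs)

  sumℚ-map-*ˡ : ∀ k (f : A → ℚ) xs →
                sumℚ (map (λ x → k *q f x) xs) ≡ k *q sumℚ (map f xs)
  sumℚ-map-*ˡ k f [] = sym (ℚP.*-zeroʳ k)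
  sumℚ-map-*ˡ k f (x ∷ xs) =
    trans (cong (k *q f x +q_) (sumℚ-map-*ˡ k f xs)) (sym (ℚP.*-distribˡ-+ k (f x) _))

  sumℚ-map-*ʳ : ∀ k (f : A → ℚ) xs →
                sumℚ (map (λ x → f x *q k) xs) ≡ sumℚ (map f xs) *q k
  sumℚ-map-*ʳ k f [] = sym (ℚP.*-zeroˡ k)
  sumℚ-map-*ʳ k f (x ∷ xs) =
    trans (cong (f x *q k +q_) (sumℚ-map-*ʳ k f xs)) (sym (ℚP.*-distribʳ-+ k (f x) _))

  sumℚ-map-+ : ∀ (f g : A → ℚ) xs →
               sumℚ (map (λ x → f x +q g x) xs) ≡ sumℚ (map f xs) +q sumℚ (map g xs)
  sumℚ-map-+ f g [] = refl
  sumℚ-map-+ f g (x ∷ xs) =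
    trans (cong (f x +q g x +q_) (sumℚ-map-+ f g xs))
          (solve 4 (λ a b c d → (a :+ b) :+ (c :+ d) := (a :+ c) :+ (b :+ d)) refl
                   (f x) (g x) _ _)

  sumℚ-map-concatMap : ∀ {B : Set} (f : B → ℚ) (g : A → List B) xs →
    sumℚ (map f (concatMap g xs)) ≡ sumℚ (map (λ x → sumℚ (map f (g x))) xs)
  sumℚ-map-concatMap f g [] = refl
  sumℚ-map-concatMap f g (x ∷ xs) = begin
    sumℚ (map f (g x ++ concatMap g xs))
      ≡⟨ cong sumℚ (ListP.map-++ f (g x) _) ⟩
    sumℚ (map f (g x) ++ map f (concatMap g xs))
      ≡⟨ sumℚ-++ (map f (g x)) _ ⟩
    sumℚ (map f (g x)) +q sumℚ (map f (concatMap g xs))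
      ≡⟨ cong (sumℚ (map f (g x)) +q_) (sumℚ-map-concatMap f g xs) ⟩
    sumℚ (map (λ y → sumℚ (map f (g y))) (x ∷ xs)) ∎
    where open ≡-Reasoning

  sumℚ-map-map : ∀ {B : Set} (f : B → ℚ) (g : A → B) xs →
                 sumℚ (map f (map g xs)) ≡ sumℚ (map (λ x → f (g x)) xs)
  sumℚ-map-map f g xs = cong sumℚ (sym (ListP.map-∘ xs))

𝟙 : ∀ {P : Set} → Dec P → ℚ
𝟙 (yes _) = 1ℚ
𝟙 (no _)  = 0ℚ

𝟙-yes : ∀ {P : Set} (d : Dec P) → P → 𝟙 d ≡ 1ℚ
𝟙-yes (yes _) p = refl
𝟙-yes (no ¬p) p = ⊥-elim (¬p p)

𝟙-no : ∀ {P : Set} (d : Dec P) → ¬ P → 𝟙 d ≡ 0ℚ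
𝟙-no (yes p) ¬p = ⊥-elim (¬p p)
𝟙-no (no _)  ¬p = refl

𝟙-⇔ : ∀ {P Q : Set} → (P → Q) → (Q → P) → (d : Dec P) (e : Dec Q) →
      𝟙 d ≡ 𝟙 e
𝟙-⇔ to from (yes p) e = sym (𝟙-yes e (to p))
𝟙-⇔ to from (no ¬p) e = sym (𝟙-no e (λ q → ¬p (from q)))

𝟙-× : ∀ {P Q : Set} (d : Dec P) (e : Dec Q) → 𝟙 d *q 𝟙 e ≡ 𝟙 (d ×-dec e)
𝟙-× (yes p) (yes q) = refl
𝟙-× (yes p) (no ¬q) = refl
𝟙-× (no ¬p) e       = ℚP.*-zeroˡ (𝟙 e)

sumPairs : ∀ {A B : Set} → List (A × B) → (A → B → ℚ) → ℚ
sumPairs ps F = sumℚ (map (λ p → F (proj₁ p) (proj₂ p)) ps)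

module Coefficients (L : Set) (_≟L_ : DecidableEquality L) (_∘_ : L → L → L)
  (factorisations : L → List (L × L))
  (factorisations-exact : ∀ a b c →
     sumPairs (factorisations c) (λ x y → 𝟙 (a ≟L x) *q 𝟙 (b ≟L y))
     ≡ 𝟙 ((a ∘ b) ≟L c))
  where

  open FormalSums L _≟L_
  open Stuffle _∘_

  Coeffs : Set
  Coeffs = Word → ℚ

  δ : Word → Coeffs
  δ v w = 𝟙 (v ≟W w)

  ∂ : L → Coeffs → Coeffs
  ∂ a f w = f (a ∷ w)

  0ᶠ : Coeffs
  0ᶠ w = 0ℚ

  _·ᶠ_ : ℚ → Coeffs → Coeffs
  (k ·ᶠ f) w = k *q f w

  _+ᶠ_ : Coeffs → Coeffs → Coeffs
  (f +ᶠ g) w = f w +q g w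

  -- The stuffle product transported to coefficient functions: the first letter c of
  -- a word of u * v is the first letter of u, of v, or a product a ∘ b ≡ c of both.
  _⋆_ : Coeffs → Coeffs → Coeffs
  (f ⋆ g) [] = f [] *q g []
  (f ⋆ g) (c ∷ w) = (∂ c f ⋆ g) w +q ((f ⋆ ∂ c g) w +q
    sumPairs (factorisations c) (λ a b → (∂ a f ⋆ ∂ b g) w))

  ⋆-cong : ∀ {f f′ g g′} → f ≗ f′ → g ≗ g′ → f ⋆ g ≗ f′ ⋆ g′
  ⋆-cong f≗ g≗ [] = cong₂ _*q_ (f≗ []) (g≗ [])
  ⋆-cong f≗ g≗ (c ∷ w) =
    cong₂ _+q_ (⋆-cong (λ v → f≗ (c ∷ v)) g≗ w)
      (cong₂ _+q_ (⋆-cong f≗ (λ v → g≗ (c ∷ v)) w)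
        (sumℚ-map-cong (λ (a , b) → ⋆-cong (λ v → f≗ (a ∷ v)) (λ v → g≗ (b ∷ v)) w)
                       (factorisations c)))

  private
    *-distribˡ-+₃ : ∀ k a b c → k *q a +q (k *q b +q k *q c) ≡ k *q (a +q (b +q c))
    *-distribˡ-+₃ =
      solve 4 (λ k a b c → k :* a :+ (k :* b :+ k :* c) := k :* (a :+ (b :+ c))) refl

    +-interchange₃ : ∀ a a′ b b′ c c′ →
      (a +q a′) +q ((b +q b′) +q (c +q c′)) ≡ (a +q (b +q c)) +q (a′ +q (b′ +q c′))
    +-interchange₃ = solve 6 (λ a a′ b b′ c c′ →
      (a :+ a′) :+ ((b :+ b′) :+ (c :+ c′)) := (a :+ (b :+ c)) :+ (a′ :+ (b′ :+ c′))) refl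

  ⋆-scaleˡ : ∀ k f g → (k ·ᶠ f) ⋆ g ≗ k ·ᶠ (f ⋆ g)
  ⋆-scaleˡ k f g [] = ℚP.*-assoc k (f []) (g [])
  ⋆-scaleˡ k f g (c ∷ w) = trans
    (cong₂ _+q_ (⋆-scaleˡ k (∂ c f) g w) (cong₂ _+q_ (⋆-scaleˡ k f (∂ c g) w)
      (trans (sumℚ-map-cong (λ (a , b) → ⋆-scaleˡ k (∂ a f) (∂ b g) w) (factorisations c))
             (sumℚ-map-*ˡ k _ (factorisations c)))))
    (*-distribˡ-+₃ k _ _ _)

  ⋆-scaleʳ : ∀ k f g → f ⋆ (k ·ᶠ g) ≗ k ·ᶠ (f ⋆ g)
  ⋆-scaleʳ k f g [] = solve 3 (λ a k b → a :* (k :* b) := k :* (a :* b)) refl (f []) k (g [])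
  ⋆-scaleʳ k f g (c ∷ w) = trans
    (cong₂ _+q_ (⋆-scaleʳ k (∂ c f) g w) (cong₂ _+q_ (⋆-scaleʳ k f (∂ c g) w)
      (trans (sumℚ-map-cong (λ (a , b) → ⋆-scaleʳ k (∂ a f) (∂ b g) w) (factorisations c))
             (sumℚ-map-*ˡ k _ (factorisations c)))))
    (*-distribˡ-+₃ k _ _ _)

  ⋆-distribʳ-+ᶠ : ∀ f f′ g → (f +ᶠ f′) ⋆ g ≗ (f ⋆ g) +ᶠ (f′ ⋆ g)
  ⋆-distribʳ-+ᶠ f f′ g [] = ℚP.*-distribʳ-+ (g []) (f []) (f′ [])
  ⋆-distribʳ-+ᶠ f f′ g (c ∷ w) = trans
    (cong₂ _+q_ (⋆-distribʳ-+ᶠ (∂ c f) (∂ c f′) g w)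
      (cong₂ _+q_ (⋆-distribʳ-+ᶠ f f′ (∂ c g) w)
        (trans (sumℚ-map-cong (λ (a , b) → ⋆-distribʳ-+ᶠ (∂ a f) (∂ a f′) (∂ b g) w)
                              (factorisations c))
               (sumℚ-map-+ _ _ (factorisations c)))))
    (+-interchange₃ ((∂ c f ⋆ g) w) ((∂ c f′ ⋆ g) w) ((f ⋆ ∂ c g) w) ((f′ ⋆ ∂ c g) w) _ _)

  ⋆-distribˡ-+ᶠ : ∀ f g g′ → f ⋆ (g +ᶠ g′) ≗ (f ⋆ g) +ᶠ (f ⋆ g′)
  ⋆-distribˡ-+ᶠ f g g′ [] = ℚP.*-distribˡ-+ (f []) (g []) (g′ [])
  ⋆-distribˡ-+ᶠ f g g′ (c ∷ w) = trans
    (cong₂ _+q_ (⋆-distribˡ-+ᶠ (∂ c f) g g′ w)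
      (cong₂ _+q_ (⋆-distribˡ-+ᶠ f (∂ c g) (∂ c g′) w)
        (trans (sumℚ-map-cong (λ (a , b) → ⋆-distribˡ-+ᶠ (∂ a f) (∂ b g) (∂ b g′) w)
                              (factorisations c))
               (sumℚ-map-+ _ _ (factorisations c)))))
    (+-interchange₃ ((∂ c f ⋆ g) w) ((∂ c f ⋆ g′) w) ((f ⋆ ∂ c g) w) ((f ⋆ ∂ c g′) w) _ _)

  ⋆-zeroˡ : ∀ g → 0ᶠ ⋆ g ≗ 0ᶠ
  ⋆-zeroˡ g w = trans (⋆-scaleˡ 0ℚ 0ᶠ g w) (ℚP.*-zeroˡ ((0ᶠ ⋆ g) w))

  ⋆-zeroʳ : ∀ f → f ⋆ 0ᶠ ≗ 0ᶠ
  ⋆-zeroʳ f w = trans (⋆-scaleʳ 0ℚ f 0ᶠ w) (ℚP.*-zeroˡ ((f ⋆ 0ᶠ) w))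

  ⋆-identityˡ : ∀ g → δ [] ⋆ g ≗ g
  ⋆-identityˡ g [] = ℚP.*-identityˡ (g [])
  ⋆-identityˡ g (c ∷ w) = trans
    (cong₂ _+q_ (⋆-zeroˡ g w) (cong₂ _+q_ (⋆-identityˡ (∂ c g) w)
      (sumℚ-map-zero (λ p → ⋆-zeroˡ (∂ (proj₂ p) g) w) (factorisations c))))
    (trans (ℚP.+-identityˡ _) (ℚP.+-identityʳ _))

  ⋆-identityʳ : ∀ f → f ⋆ δ [] ≗ f
  ⋆-identityʳ f [] = ℚP.*-identityʳ (f [])
  ⋆-identityʳ f (c ∷ w) = trans
    (cong₂ _+q_ (⋆-identityʳ (∂ c f) w) (cong₂ _+q_ (⋆-zeroʳ f w)
      (sumℚ-map-zero (λ p → ⋆-zeroʳ (∂ (proj₁ p) f) w) (factorisations c))))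
    (trans (cong (f (c ∷ w) +q_) (ℚP.+-identityˡ _)) (ℚP.+-identityʳ _))

  coeff-∷ : ∀ c v u w → coeff ((c , v) ∷ u) w ≡ c *q δ v w +q coeff u w
  coeff-∷ c v u w with v ≟W w
  ... | yes _ = cong (_+q coeff u w) (sym (ℚP.*-identityʳ c))
  ... | no _  =
    trans (sym (ℚP.+-identityˡ (coeff u w))) (cong (_+q coeff u w) (sym (ℚP.*-zeroʳ c)))

  coeff-⟦⟧ : ∀ v → coeff ⟦ v ⟧ ≗ δ v
  coeff-⟦⟧ v w = trans (coeff-∷ 1ℚ v [] w) (trans (ℚP.+-identityʳ _) (ℚP.*-identityˡ _))

  coeff-⊕ : ∀ u u′ w → coeff (u ⊕ u′) w ≡ coeff u w +q coeff u′ w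
  coeff-⊕ [] u′ w = sym (ℚP.+-identityˡ _)
  coeff-⊕ ((c , v) ∷ u) u′ w = begin
    coeff ((c , v) ∷ u ++ u′) w                 ≡⟨ coeff-∷ c v (u ++ u′) w ⟩
    c *q δ v w +q coeff (u ++ u′) w             ≡⟨ cong (c *q δ v w +q_) (coeff-⊕ u u′ w) ⟩
    c *q δ v w +q (coeff u w +q coeff u′ w)     ≡⟨ sym (ℚP.+-assoc (c *q δ v w) _ _) ⟩
    (c *q δ v w +q coeff u w) +q coeff u′ w     ≡⟨ cong (_+q coeff u′ w) (sym (coeff-∷ c v u w)) ⟩
    coeff ((c , v) ∷ u) w +q coeff u′ w         ∎
    where open ≡-Reasoning

  coeff-· : ∀ k u w → coeff (k · u) w ≡ k *q coeff u w
  coeff-· k [] w = sym (ℚP.*-zeroʳ k)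
  coeff-· k ((c , v) ∷ u) w = begin
    coeff ((k *q c , v) ∷ k · u) w
      ≡⟨ coeff-∷ (k *q c) v (k · u) w ⟩
    (k *q c) *q δ v w +q coeff (k · u) w
      ≡⟨ cong ((k *q c) *q δ v w +q_) (coeff-· k u w) ⟩
    (k *q c) *q δ v w +q k *q coeff u w
      ≡⟨ solve 4 (λ k c d x → (k :* c) :* d :+ k :* x := k :* (c :* d :+ x)) refl
                 k c (δ v w) (coeff u w) ⟩
    k *q (c *q δ v w +q coeff u w)
      ≡⟨ cong (k *q_) (sym (coeff-∷ c v u w)) ⟩
    k *q coeff ((c , v) ∷ u) w ∎
    where open ≡-Reasoning

  δ-∷ : ∀ a v b w → δ (a ∷ v) (b ∷ w) ≡ 𝟙 (a ≟L b) *q δ v w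
  δ-∷ a v b w = trans
    (𝟙-⇔ (λ e → ListP.∷-injectiveˡ e , ListP.∷-injectiveʳ e) (λ (a≡b , v≡w) → cong₂ _∷_ a≡b v≡w)
         ((a ∷ v) ≟W (b ∷ w)) ((a ≟L b) ×-dec (v ≟W w)))
    (sym (𝟙-× (a ≟L b) (v ≟W w)))

  ∂-δ : ∀ a v c → ∂ c (δ (a ∷ v)) ≗ 𝟙 (a ≟L c) ·ᶠ δ v
  ∂-δ a v c = δ-∷ a v c

  coeff-prefix-[] : ∀ a u → coeff (prefix a u) [] ≡ 0ℚ
  coeff-prefix-[] a [] = refl
  coeff-prefix-[] a ((c , v) ∷ u) = coeff-prefix-[] a u

  coeff-prefix-∷ : ∀ a u c w → coeff (prefix a u) (c ∷ w) ≡ 𝟙 (a ≟L c) *q coeff u w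
  coeff-prefix-∷ a [] c w = sym (ℚP.*-zeroʳ (𝟙 (a ≟L c)))
  coeff-prefix-∷ a ((d , v) ∷ u) c w = begin
    coeff ((d , a ∷ v) ∷ prefix a u) (c ∷ w)
      ≡⟨ coeff-∷ d (a ∷ v) (prefix a u) (c ∷ w) ⟩
    d *q δ (a ∷ v) (c ∷ w) +q coeff (prefix a u) (c ∷ w)
      ≡⟨ cong₂ _+q_ (cong (d *q_) (δ-∷ a v c w)) (coeff-prefix-∷ a u c w) ⟩
    d *q (i *q δ v w) +q i *q coeff u w
      ≡⟨ solve 4 (λ d i x y → d :* (i :* x) :+ i :* y := i :* (d :* x :+ y)) refl
                 d i (δ v w) (coeff u w) ⟩
    i *q (d *q δ v w +q coeff u w)
      ≡⟨ cong (i *q_) (sym (coeff-∷ d v u w)) ⟩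
    i *q coeff ((d , v) ∷ u) w ∎
    where
    open ≡-Reasoning
    i : ℚ
    i = 𝟙 (a ≟L c)

  coeff-prefix₃-∷ : ∀ a b d x y z c w →
    coeff (prefix a x ⊕ (prefix b y ⊕ prefix d z)) (c ∷ w) ≡
    𝟙 (a ≟L c) *q coeff x w +q (𝟙 (b ≟L c) *q coeff y w +q 𝟙 (d ≟L c) *q coeff z w)
  coeff-prefix₃-∷ a b d x y z c w = trans (coeff-⊕ (prefix a x) _ (c ∷ w))
    (cong₂ _+q_ (coeff-prefix-∷ a x c w) (trans (coeff-⊕ (prefix b y) (prefix d z) (c ∷ w))
      (cong₂ _+q_ (coeff-prefix-∷ b y c w) (coeff-prefix-∷ d z c w))))

  coeff-prefix₃-[] : ∀ a b d x y z → coeff (prefix a x ⊕ (prefix b y ⊕ prefix d z)) [] ≡ 0ℚ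
  coeff-prefix₃-[] a b d x y z = trans (coeff-⊕ (prefix a x) _ [])
    (cong₂ _+q_ (coeff-prefix-[] a x) (trans (coeff-⊕ (prefix b y) (prefix d z) [])
      (cong₂ _+q_ (coeff-prefix-[] b y) (coeff-prefix-[] d z))))

  coeff-*w : ∀ w₁ w₂ → coeff (w₁ *w w₂) ≗ δ w₁ ⋆ δ w₂
  coeff-*w [] w₂ w = trans (coeff-⟦⟧ w₂ w) (sym (⋆-identityˡ (δ w₂) w))
  coeff-*w (a ∷ w₁) [] w = trans (coeff-⟦⟧ (a ∷ w₁) w) (sym (⋆-identityʳ (δ (a ∷ w₁)) w))
  coeff-*w (a ∷ w₁) (b ∷ w₂) [] =
    coeff-prefix₃-[] a b (a ∘ b) (w₁ *w (b ∷ w₂)) ((a ∷ w₁) *w w₂) (w₁ *w w₂)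
  coeff-*w (a ∷ w₁) (b ∷ w₂) (c ∷ w) =
    trans (coeff-prefix₃-∷ a b (a ∘ b) (w₁ *w (b ∷ w₂)) ((a ∷ w₁) *w w₂) (w₁ *w w₂) c w)
    (sym (cong₂ _+q_ from-left (cong₂ _+q_ from-right from-both)))
    where
    from-left : (∂ c (δ (a ∷ w₁)) ⋆ δ (b ∷ w₂)) w ≡ 𝟙 (a ≟L c) *q coeff (w₁ *w (b ∷ w₂)) w
    from-left = trans (⋆-cong (∂-δ a w₁ c) (λ _ → refl) w)
      (trans (⋆-scaleˡ (𝟙 (a ≟L c)) (δ w₁) (δ (b ∷ w₂)) w)
             (cong (𝟙 (a ≟L c) *q_) (sym (coeff-*w w₁ (b ∷ w₂) w))))

    from-right : (δ (a ∷ w₁) ⋆ ∂ c (δ (b ∷ w₂))) w ≡ 𝟙 (b ≟L c) *q coeff ((a ∷ w₁) *w w₂) w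
    from-right = trans (⋆-cong (λ _ → refl) (∂-δ b w₂ c) w)
      (trans (⋆-scaleʳ (𝟙 (b ≟L c)) (δ (a ∷ w₁)) (δ w₂) w)
             (cong (𝟙 (b ≟L c) *q_) (sym (coeff-*w (a ∷ w₁) w₂ w))))

    from-factorisation : ∀ x y → (∂ x (δ (a ∷ w₁)) ⋆ ∂ y (δ (b ∷ w₂))) w
                                 ≡ (𝟙 (a ≟L x) *q 𝟙 (b ≟L y)) *q coeff (w₁ *w w₂) w
    from-factorisation x y = begin
      (∂ x (δ (a ∷ w₁)) ⋆ ∂ y (δ (b ∷ w₂))) w     ≡⟨ ⋆-cong (∂-δ a w₁ x) (∂-δ b w₂ y) w ⟩
      ((i ·ᶠ δ w₁) ⋆ (j ·ᶠ δ w₂)) w               ≡⟨ ⋆-scaleˡ i (δ w₁) (j ·ᶠ δ w₂) w ⟩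
      i *q ((δ w₁ ⋆ (j ·ᶠ δ w₂)) w)               ≡⟨ cong (i *q_) (⋆-scaleʳ j (δ w₁) (δ w₂) w) ⟩
      i *q (j *q (δ w₁ ⋆ δ w₂) w)                 ≡⟨ sym (ℚP.*-assoc i j _) ⟩
      (i *q j) *q (δ w₁ ⋆ δ w₂) w                 ≡⟨ cong ((i *q j) *q_) (sym (coeff-*w w₁ w₂ w)) ⟩
      (i *q j) *q coeff (w₁ *w w₂) w              ∎
      where
      open ≡-Reasoning
      i j : ℚ
      i = 𝟙 (a ≟L x)
      j = 𝟙 (b ≟L y)

    from-both : sumPairs (factorisations c) (λ x y → (∂ x (δ (a ∷ w₁)) ⋆ ∂ y (δ (b ∷ w₂))) w)
                ≡ 𝟙 ((a ∘ b) ≟L c) *q coeff (w₁ *w w₂) w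
    from-both = trans (sumℚ-map-cong (λ (x , y) → from-factorisation x y) (factorisations c))
      (trans (sumℚ-map-*ʳ (coeff (w₁ *w w₂) w) (λ p → 𝟙 (a ≟L proj₁ p) *q 𝟙 (b ≟L proj₂ p))
                          (factorisations c))
             (cong (_*q coeff (w₁ *w w₂) w) (factorisations-exact a b c)))

  coeff-*-monomial : ∀ c v u → coeff (concatMap (λ q → (c *q proj₁ q) · (v *w proj₂ q)) u)
                               ≗ (c ·ᶠ δ v) ⋆ coeff u
  coeff-*-monomial c v [] w = sym (⋆-zeroʳ (c ·ᶠ δ v) w)
  coeff-*-monomial c v ((d , v′) ∷ u) w = begin
    coeff ((c *q d) · (v *w v′) ++ rest) w
      ≡⟨ coeff-⊕ ((c *q d) · (v *w v′)) rest w ⟩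
    coeff ((c *q d) · (v *w v′)) w +q coeff rest w
      ≡⟨ cong₂ _+q_ (coeff-· (c *q d) (v *w v′) w) (coeff-*-monomial c v u w) ⟩
    (c *q d) *q coeff (v *w v′) w +q ((c ·ᶠ δ v) ⋆ coeff u) w
      ≡⟨ cong (_+q ((c ·ᶠ δ v) ⋆ coeff u) w) monomial ⟩
    ((c ·ᶠ δ v) ⋆ (d ·ᶠ δ v′)) w +q ((c ·ᶠ δ v) ⋆ coeff u) w
      ≡⟨ sym (⋆-distribˡ-+ᶠ (c ·ᶠ δ v) (d ·ᶠ δ v′) (coeff u) w) ⟩
    ((c ·ᶠ δ v) ⋆ ((d ·ᶠ δ v′) +ᶠ coeff u)) w
      ≡⟨ sym (⋆-cong (λ _ → refl) (coeff-∷ d v′ u) w) ⟩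
    ((c ·ᶠ δ v) ⋆ coeff ((d , v′) ∷ u)) w ∎
    where
    open ≡-Reasoning
    rest : Elem
    rest = concatMap (λ q → (c *q proj₁ q) · (v *w proj₂ q)) u
    monomial : (c *q d) *q coeff (v *w v′) w ≡ ((c ·ᶠ δ v) ⋆ (d ·ᶠ δ v′)) w
    monomial = begin
      (c *q d) *q coeff (v *w v′) w
        ≡⟨ cong ((c *q d) *q_) (coeff-*w v v′ w) ⟩
      (c *q d) *q (δ v ⋆ δ v′) w
        ≡⟨ solve 3 (λ c d x → (c :* d) :* x := d :* (c :* x)) refl c d ((δ v ⋆ δ v′) w) ⟩
      d *q (c *q (δ v ⋆ δ v′) w)
        ≡⟨ cong (d *q_) (sym (⋆-scaleˡ c (δ v) (δ v′) w)) ⟩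
      d *q ((c ·ᶠ δ v) ⋆ δ v′) w
        ≡⟨ sym (⋆-scaleʳ d (c ·ᶠ δ v) (δ v′) w) ⟩
      ((c ·ᶠ δ v) ⋆ (d ·ᶠ δ v′)) w ∎

  coeff-* : ∀ u v → coeff (u * v) ≗ coeff u ⋆ coeff v
  coeff-* [] v w = sym (⋆-zeroˡ (coeff v) w)
  coeff-* ((c , v′) ∷ u) v w = begin
    coeff (concatMap (λ q → (c *q proj₁ q) · (v′ *w proj₂ q)) v ++ u * v) w
      ≡⟨ coeff-⊕ (concatMap (λ q → (c *q proj₁ q) · (v′ *w proj₂ q)) v) (u * v) w ⟩
    coeff (concatMap (λ q → (c *q proj₁ q) · (v′ *w proj₂ q)) v) w +q coeff (u * v) w
      ≡⟨ cong₂ _+q_ (coeff-*-monomial c v′ v w) (coeff-* u v w) ⟩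
    ((c ·ᶠ δ v′) ⋆ coeff v) w +q (coeff u ⋆ coeff v) w
      ≡⟨ sym (⋆-distribʳ-+ᶠ (c ·ᶠ δ v′) (coeff u) (coeff v) w) ⟩
    (((c ·ᶠ δ v′) +ᶠ coeff u) ⋆ coeff v) w
      ≡⟨ sym (⋆-cong (coeff-∷ c v′ u) (λ _ → refl) w) ⟩
    (coeff ((c , v′) ∷ u) ⋆ coeff v) w ∎
    where open ≡-Reasoning

splittings : ℕ → List (ℕ × ℕ)
splittings zero = (0 , 0) ∷ []
splittings (suc k) = (0 , suc k) ∷ map (map₁ suc) (splittings k)

∘H-factorisations : ℕ → List (ℕ × ℕ)
∘H-factorisations zero = []
∘H-factorisations (suc k) = splittings k

𝟙-suc : ∀ a b → 𝟙 (suc a ≟ℕ suc b) ≡ 𝟙 (a ≟ℕ b)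
𝟙-suc a b = 𝟙-⇔ NatP.suc-injective (cong suc) (suc a ≟ℕ suc b) (a ≟ℕ b)

splittings-exact : ∀ k a b →
  sumPairs (splittings k) (λ x y → 𝟙 (a ≟ℕ x) *q 𝟙 (b ≟ℕ y)) ≡ 𝟙 ((a + b) ≟ℕ k)
splittings-exact zero a b = trans (ℚP.+-identityʳ _) (trans (𝟙-× (a ≟ℕ 0) (b ≟ℕ 0))
  (𝟙-⇔ (λ (a≡0 , b≡0) → cong₂ _+_ a≡0 b≡0)
       (λ a+b≡0 → NatP.m+n≡0⇒m≡0 a a+b≡0 , NatP.m+n≡0⇒n≡0 a a+b≡0)
       ((a ≟ℕ 0) ×-dec (b ≟ℕ 0)) ((a + b) ≟ℕ 0)))
splittings-exact (suc k) zero b = trans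
  (cong₂ _+q_ (ℚP.*-identityˡ (𝟙 (b ≟ℕ suc k)))
    (trans (sumℚ-map-map _ (map₁ suc) (splittings k))
           (sumℚ-map-zero (λ p → ℚP.*-zeroˡ (𝟙 (b ≟ℕ proj₂ p))) (splittings k))))
  (ℚP.+-identityʳ _)
splittings-exact (suc k) (suc a) b = trans
  (cong₂ _+q_ (ℚP.*-zeroˡ (𝟙 (b ≟ℕ suc k)))
    (trans (sumℚ-map-map _ (map₁ suc) (splittings k))
    (trans (sumℚ-map-cong (λ p → cong (_*q 𝟙 (b ≟ℕ proj₂ p)) (𝟙-suc a (proj₁ p))) (splittings k))
           (splittings-exact k a b))))
  (trans (ℚP.+-identityˡ _) (sym (𝟙-suc (a + b) k)))

∘H-factorisations-exact : ∀ a b c →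
  sumPairs (∘H-factorisations c) (λ x y → 𝟙 (a ≟ℕ x) *q 𝟙 (b ≟ℕ y)) ≡ 𝟙 ((a ∘H b) ≟ℕ c)
∘H-factorisations-exact a b zero = sym (𝟙-no (suc (a + b) ≟ℕ 0) (λ ()))
∘H-factorisations-exact a b (suc k) = trans (splittings-exact k a b) (sym (𝟙-suc (a + b) k))

parityLifts : Bool → ℕ × ℕ → List (LetterE × LetterE)
parityLifts p (i , j) = ((i , false) , (j , p)) ∷ ((i , true) , (j , not p)) ∷ []

∘E-factorisations : LetterE → List (LetterE × LetterE)
∘E-factorisations (m , p) = concatMap (parityLifts p) (∘H-factorisations m)

𝟙-≟LE : ∀ m p n q → 𝟙 ((m , p) ≟LE (n , q)) ≡ 𝟙 (m ≟ℕ n) *q 𝟙 (p ≟𝔹 q)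
𝟙-≟LE m p n q = trans
  (𝟙-⇔ (λ e → cong proj₁ e , cong proj₂ e) (λ (m≡n , p≡q) → cong₂ _,_ m≡n p≡q)
       ((m , p) ≟LE (n , q)) ((m ≟ℕ n) ×-dec (p ≟𝔹 q)))
  (sym (𝟙-× (m ≟ℕ n) (p ≟𝔹 q)))

𝟙-xor : ∀ p q r → 𝟙 (p ≟𝔹 false) *q 𝟙 (q ≟𝔹 r) +q 𝟙 (p ≟𝔹 true) *q 𝟙 (q ≟𝔹 not r)
                  ≡ 𝟙 ((p xor q) ≟𝔹 r)
𝟙-xor false false false = refl
𝟙-xor false false true  = refl
𝟙-xor false true  false = refl
𝟙-xor false true  true  = refl
𝟙-xor true  false false = refl
𝟙-xor true  false true  = refl
𝟙-xor true  true  false = refl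
𝟙-xor true  true  true  = refl

∘E-factorisations-exact : ∀ a b c →
  sumPairs (∘E-factorisations c) (λ x y → 𝟙 (a ≟LE x) *q 𝟙 (b ≟LE y)) ≡ 𝟙 ((a ∘E b) ≟LE c)
∘E-factorisations-exact (m₁ , p₁) (m₂ , p₂) (m , p) = begin
  sumPairs (concatMap (parityLifts p) (∘H-factorisations m)) F
    ≡⟨ sumℚ-map-concatMap _ (parityLifts p) (∘H-factorisations m) ⟩
  sumℚ (map (λ ij → sumPairs (parityLifts p ij) F) (∘H-factorisations m))
    ≡⟨ sumℚ-map-cong over-lifts (∘H-factorisations m) ⟩
  sumℚ (map (λ ij → FH (proj₁ ij) (proj₂ ij) *q 𝟙 ((p₁ xor p₂) ≟𝔹 p)) (∘H-factorisations m))
    ≡⟨ sumℚ-map-*ʳ _ (λ ij → FH (proj₁ ij) (proj₂ ij)) (∘H-factorisations m) ⟩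
  sumPairs (∘H-factorisations m) FH *q 𝟙 ((p₁ xor p₂) ≟𝔹 p)
    ≡⟨ cong (_*q _) (∘H-factorisations-exact m₁ m₂ m) ⟩
  𝟙 ((m₁ ∘H m₂) ≟ℕ m) *q 𝟙 ((p₁ xor p₂) ≟𝔹 p)
    ≡⟨ sym (𝟙-≟LE (m₁ ∘H m₂) (p₁ xor p₂) m p) ⟩
  𝟙 (((m₁ , p₁) ∘E (m₂ , p₂)) ≟LE (m , p)) ∎
  where
  open ≡-Reasoning
  F : LetterE → LetterE → ℚ
  F x y = 𝟙 ((m₁ , p₁) ≟LE x) *q 𝟙 ((m₂ , p₂) ≟LE y)
  FH : ℕ → ℕ → ℚ
  FH i j = 𝟙 (m₁ ≟ℕ i) *q 𝟙 (m₂ ≟ℕ j)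
  over-lifts : ∀ ij →
    sumPairs (parityLifts p ij) F ≡ FH (proj₁ ij) (proj₂ ij) *q 𝟙 ((p₁ xor p₂) ≟𝔹 p)
  over-lifts (i , j) = begin
    F (i , false) (j , p) +q (F (i , true) (j , not p) +q 0ℚ)
      ≡⟨ cong (F (i , false) (j , p) +q_) (ℚP.+-identityʳ _) ⟩
    F (i , false) (j , p) +q F (i , true) (j , not p)
      ≡⟨ cong₂ _+q_ (cong₂ _*q_ (𝟙-≟LE m₁ p₁ i false) (𝟙-≟LE m₂ p₂ j p))
                    (cong₂ _*q_ (𝟙-≟LE m₁ p₁ i true) (𝟙-≟LE m₂ p₂ j (not p))) ⟩
    (α *q x₁) *q (β *q y₁) +q (α *q x₂) *q (β *q y₂)
      ≡⟨ solve 6 (λ α x₁ β y₁ x₂ y₂ → (α :* x₁) :* (β :* y₁) :+ (α :* x₂) :* (β :* y₂)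
                    := (α :* β) :* (x₁ :* y₁ :+ x₂ :* y₂)) refl α x₁ β y₁ x₂ y₂ ⟩
    (α *q β) *q (x₁ *q y₁ +q x₂ *q y₂)
      ≡⟨ cong ((α *q β) *q_) (𝟙-xor p₁ p₂ p) ⟩
    FH i j *q 𝟙 ((p₁ xor p₂) ≟𝔹 p) ∎
    where
    α β x₁ y₁ x₂ y₂ : ℚ
    α = 𝟙 (m₁ ≟ℕ i)
    β = 𝟙 (m₂ ≟ℕ j)
    x₁ = 𝟙 (p₁ ≟𝔹 false)
    y₁ = 𝟙 (p₂ ≟𝔹 p)
    x₂ = 𝟙 (p₁ ≟𝔹 true)
    y₂ = 𝟙 (p₂ ≟𝔹 not p)

module CoeffsE = Coefficients LetterE _≟LE_ _∘E_ ∘E-factorisations ∘E-factorisations-exact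
module CoeffsH = Coefficients ℕ _≟ℕ_ _∘H_ ∘H-factorisations ∘H-factorisations-exact

underlying : E2.Word → H1.Word
underlying = map proj₁

embed : H1.Word → E2.Word
embed = map (λ n → (n , false))

forgetParity≡embed∘underlying : ∀ w → forgetParity w ≡ embed (underlying w)
forgetParity≡embed∘underlying [] = refl
forgetParity≡embed∘underlying ((m , p) ∷ w) =
  cong ((m , false) ∷_) (forgetParity≡embed∘underlying w)

underlying∘embed : ∀ h → underlying (embed h) ≡ h
underlying∘embed [] = refl
underlying∘embed (n ∷ h) = cong (n ∷_) (underlying∘embed h)

underlying∘forgetParity : ∀ w → underlying (forgetParity w) ≡ underlying w
underlying∘forgetParity w =
  trans (cong underlying (forgetParity≡embed∘underlying w)) (underlying∘embed (underlying w))

2^_ : ℕ → ℚ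
2^ zero = 1ℚ
2^ suc k = (1ℚ +q 1ℚ) *q 2^ k

module Twisted (χ : Bool → ℚ) (χ-false : χ false ≡ 1ℚ) (χ-true : ∀ p → χ true *q χ (not p) ≡ χ p)
  where

  module E = CoeffsE
  module H = CoeffsH

  χʷ : E2.Word → ℚ
  χʷ [] = 1ℚ
  χʷ ((m , p) ∷ w) = χ p *q χʷ w

  Invariant : E2.Elem → Set
  Invariant u = ∀ w → E2.coeff u w ≡ χʷ w *q E2.coeff u (forgetParity w)

  weight : E2.Word → ℚ
  weight [] = 1ℚ
  weight ((m , p) ∷ w) = (½ *q χ p) *q weight w

  lift : H.Coeffs → E.Coeffs
  lift g w = weight w *q g (underlying w)

  restrict : E.Coeffs → H.Coeffs
  restrict f h = 2^ length h *q f (embed h)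

  weight-*-2^ : ∀ w → weight w *q 2^ length w ≡ χʷ w
  weight-*-2^ [] = refl
  weight-*-2^ ((m , p) ∷ w) =
    trans (solve 5 (λ h c x t y → ((h :* c) :* x) :* (t :* y) := c :* (x :* y) :* (h :* t)) refl
                   ½ (χ p) (weight w) (1ℚ +q 1ℚ) (2^ length w))
          (trans (ℚP.*-identityʳ _) (cong (χ p *q_) (weight-*-2^ w)))

  χʷ-embed : ∀ h → χʷ (embed h) ≡ 1ℚ
  χʷ-embed [] = refl
  χʷ-embed (n ∷ h) = cong₂ _*q_ χ-false (χʷ-embed h)

  weight-forgetParity : ∀ w → weight w ≡ χʷ w *q weight (forgetParity w)
  weight-forgetParity [] = refl
  weight-forgetParity ((m , p) ∷ w) =
    trans (cong ((½ *q χ p) *q_) (weight-forgetParity w))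
    (trans (solve 4 (λ h c x y → (h :* c) :* (x :* y) := (c :* x) :* (h :* y)) refl
                    ½ (χ p) (χʷ w) (weight (forgetParity w)))
           (cong (λ z → (χ p *q χʷ w) *q ((½ *q z) *q weight (forgetParity w))) (sym χ-false)))

  lift-invariant : ∀ g w → lift g w ≡ χʷ w *q lift g (forgetParity w)
  lift-invariant g w =
    trans (cong (_*q g (underlying w)) (weight-forgetParity w))
    (trans (ℚP.*-assoc (χʷ w) (weight (forgetParity w)) (g (underlying w)))
           (cong (λ h → χʷ w *q (weight (forgetParity w) *q g h))
                 (sym (underlying∘forgetParity w))))

  invariant⇒lift∘restrict : ∀ u → Invariant u → E2.coeff u ≗ lift (restrict (E2.coeff u))
  invariant⇒lift∘restrict u inv w = trans (inv w) (sym (begin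
    weight w *q (2^ length (underlying w) *q E2.coeff u (embed (underlying w)))
      ≡⟨ cong₂ (λ n v → weight w *q (2^ n *q E2.coeff u v))
               (ListP.length-map proj₁ w) (sym (forgetParity≡embed∘underlying w)) ⟩
    weight w *q (2^ length w *q E2.coeff u (forgetParity w))
      ≡⟨ sym (ℚP.*-assoc (weight w) _ _) ⟩
    (weight w *q 2^ length w) *q E2.coeff u (forgetParity w)
      ≡⟨ cong (_*q E2.coeff u (forgetParity w)) (weight-*-2^ w) ⟩
    χʷ w *q E2.coeff u (forgetParity w) ∎))
    where open ≡-Reasoning

  restrict∘lift : ∀ g → restrict (lift g) ≗ g
  restrict∘lift g h = begin
    2^ length h *q (weight (embed h) *q g (underlying (embed h)))
      ≡⟨ cong (λ v → 2^ length h *q (weight (embed h) *q g v)) (underlying∘embed h) ⟩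
    2^ length h *q (weight (embed h) *q g h)
      ≡⟨ sym (ℚP.*-assoc (2^ length h) _ (g h)) ⟩
    (2^ length h *q weight (embed h)) *q g h
      ≡⟨ cong (_*q g h) (ℚP.*-comm (2^ length h) _) ⟩
    (weight (embed h) *q 2^ length h) *q g h
      ≡⟨ cong (λ n → (weight (embed h) *q 2^ n) *q g h) (sym (ListP.length-map _ h)) ⟩
    (weight (embed h) *q 2^ length (embed h)) *q g h
      ≡⟨ cong (_*q g h) (trans (weight-*-2^ (embed h)) (χʷ-embed h)) ⟩
    1ℚ *q g h
      ≡⟨ ℚP.*-identityˡ (g h) ⟩
    g h ∎
    where open ≡-Reasoning

  ∂-lift : ∀ m p g → E.∂ (m , p) (lift g) ≗ (½ *q χ p) E.·ᶠ lift (H.∂ m g)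
  ∂-lift m p g v = ℚP.*-assoc (½ *q χ p) (weight v) (g (m ∷ underlying v))

  parity-average : ∀ p x →
    (½ *q χ false) *q ((½ *q χ p) *q x) +q (½ *q χ true) *q ((½ *q χ (not p)) *q x)
    ≡ (½ *q χ p) *q x
  parity-average p x = begin
    (½ *q χ false) *q ((½ *q χ p) *q x) +q (½ *q χ true) *q ((½ *q χ (not p)) *q x)
      ≡⟨ solve 6 (λ h c₀ cp c₁ cn x →
                    (h :* c₀) :* ((h :* cp) :* x) :+ (h :* c₁) :* ((h :* cn) :* x)
                    := (h :* h) :* ((c₀ :* cp :+ c₁ :* cn) :* x)) refl
                 ½ (χ false) (χ p) (χ true) (χ (not p)) x ⟩
    (½ *q ½) *q ((χ false *q χ p +q χ true *q χ (not p)) *q x)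
      ≡⟨ cong₂ (λ a b → (½ *q ½) *q ((a *q χ p +q b) *q x)) χ-false (χ-true p) ⟩
    (½ *q ½) *q ((1ℚ *q χ p +q χ p) *q x)
      ≡⟨ solve 2 (λ c x → (con ½ :* con ½) :* ((con 1ℚ :* c :+ c) :* x) := (con ½ :* c) :* x) refl
                 (χ p) x ⟩
    (½ *q χ p) *q x ∎
    where open ≡-Reasoning

  LiftMultiplicativeAt : E2.Word → Set
  LiftMultiplicativeAt w = ∀ g₁ g₂ → lift (g₁ H.⋆ g₂) w ≡ (lift g₁ E.⋆ lift g₂) w

  ∂-⋆-∂-lift : ∀ w → LiftMultiplicativeAt w → ∀ g₁ g₂ i q j r →
    (E.∂ (i , q) (lift g₁) E.⋆ E.∂ (j , r) (lift g₂)) w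
    ≡ (½ *q χ q) *q ((½ *q χ r) *q lift (H.∂ i g₁ H.⋆ H.∂ j g₂) w)
  ∂-⋆-∂-lift w lift-⋆-w g₁ g₂ i q j r = begin
    (E.∂ (i , q) (lift g₁) E.⋆ E.∂ (j , r) (lift g₂)) w
      ≡⟨ E.⋆-cong (∂-lift i q g₁) (∂-lift j r g₂) w ⟩
    ((a E.·ᶠ lift (H.∂ i g₁)) E.⋆ (b E.·ᶠ lift (H.∂ j g₂))) w
      ≡⟨ E.⋆-scaleˡ a (lift (H.∂ i g₁)) _ w ⟩
    a *q (lift (H.∂ i g₁) E.⋆ (b E.·ᶠ lift (H.∂ j g₂))) w
      ≡⟨ cong (a *q_) (E.⋆-scaleʳ b (lift (H.∂ i g₁)) (lift (H.∂ j g₂)) w) ⟩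
    a *q (b *q (lift (H.∂ i g₁) E.⋆ lift (H.∂ j g₂)) w)
      ≡⟨ cong (λ z → a *q (b *q z)) (sym (lift-⋆-w (H.∂ i g₁) (H.∂ j g₂))) ⟩
    a *q (b *q lift (H.∂ i g₁ H.⋆ H.∂ j g₂) w) ∎
    where
    open ≡-Reasoning
    a b : ℚ
    a = ½ *q χ q
    b = ½ *q χ r

  sum-∘E-factorisations-lift : ∀ w → LiftMultiplicativeAt w → ∀ g₁ g₂ m p →
    sumPairs (∘E-factorisations (m , p)) (λ x y → (E.∂ x (lift g₁) E.⋆ E.∂ y (lift g₂)) w)
    ≡ (½ *q χ p) *q (weight w *q
        sumPairs (∘H-factorisations m) (λ i j → (H.∂ i g₁ H.⋆ H.∂ j g₂) (underlying w)))
  sum-∘E-factorisations-lift w lift-⋆-w g₁ g₂ m p = begin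
    sumPairs (concatMap (parityLifts p) (∘H-factorisations m)) F
      ≡⟨ sumℚ-map-concatMap _ (parityLifts p) (∘H-factorisations m) ⟩
    sumℚ (map (λ ij → sumPairs (parityLifts p ij) F) (∘H-factorisations m))
      ≡⟨ sumℚ-map-cong over-lifts (∘H-factorisations m) ⟩
    sumℚ (map (λ ij → (½ *q χ p) *q (weight w *q G ij)) (∘H-factorisations m))
      ≡⟨ sumℚ-map-*ˡ (½ *q χ p) (λ ij → weight w *q G ij) (∘H-factorisations m) ⟩
    (½ *q χ p) *q sumℚ (map (λ ij → weight w *q G ij) (∘H-factorisations m))
      ≡⟨ cong ((½ *q χ p) *q_) (sumℚ-map-*ˡ (weight w) G (∘H-factorisations m)) ⟩
    (½ *q χ p) *q (weight w *q sumℚ (map G (∘H-factorisations m))) ∎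
    where
    open ≡-Reasoning
    F : LetterE → LetterE → ℚ
    F x y = (E.∂ x (lift g₁) E.⋆ E.∂ y (lift g₂)) w
    G : ℕ × ℕ → ℚ
    G (i , j) = (H.∂ i g₁ H.⋆ H.∂ j g₂) (underlying w)
    over-lifts : ∀ ij → sumPairs (parityLifts p ij) F ≡ (½ *q χ p) *q (weight w *q G ij)
    over-lifts (i , j) = trans (cong (F (i , false) (j , p) +q_) (ℚP.+-identityʳ _))
      (trans (cong₂ _+q_ (∂-⋆-∂-lift w lift-⋆-w g₁ g₂ i false j p)
                         (∂-⋆-∂-lift w lift-⋆-w g₁ g₂ i true j (not p)))
             (parity-average p (weight w *q G (i , j))))

  lift-⋆-at : ∀ w → LiftMultiplicativeAt w
  lift-⋆-at [] g₁ g₂ =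
    trans (ℚP.*-identityˡ _) (sym (cong₂ _*q_ (ℚP.*-identityˡ (g₁ [])) (ℚP.*-identityˡ (g₂ []))))
  lift-⋆-at ((m , p) ∷ w) g₁ g₂ = sym (begin
    (E.∂ (m , p) (lift g₁) E.⋆ lift g₂) w +q ((lift g₁ E.⋆ E.∂ (m , p) (lift g₂)) w +q
      sumPairs (∘E-factorisations (m , p)) (λ x y → (E.∂ x (lift g₁) E.⋆ E.∂ y (lift g₂)) w))
      ≡⟨ cong₂ _+q_ from-left (cong₂ _+q_ from-right
                                  (sum-∘E-factorisations-lift w (lift-⋆-at w) g₁ g₂ m p)) ⟩
    k *q (weight w *q A) +q (k *q (weight w *q B) +q k *q (weight w *q C))
      ≡⟨ solve 5 (λ k x a b c → k :* (x :* a) :+ (k :* (x :* b) :+ k :* (x :* c))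
                    := (k :* x) :* (a :+ (b :+ c))) refl k (weight w) A B C ⟩
    (k *q weight w) *q (A +q (B +q C)) ∎)
    where
    open ≡-Reasoning
    k A B C : ℚ
    k = ½ *q χ p
    A = (H.∂ m g₁ H.⋆ g₂) (underlying w)
    B = (g₁ H.⋆ H.∂ m g₂) (underlying w)
    C = sumPairs (∘H-factorisations m) (λ i j → (H.∂ i g₁ H.⋆ H.∂ j g₂) (underlying w))
    from-left : (E.∂ (m , p) (lift g₁) E.⋆ lift g₂) w ≡ k *q (weight w *q A)
    from-left = trans (E.⋆-cong (∂-lift m p g₁) (λ _ → refl) w)
      (trans (E.⋆-scaleˡ k (lift (H.∂ m g₁)) (lift g₂) w)
             (cong (k *q_) (sym (lift-⋆-at w (H.∂ m g₁) g₂))))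
    from-right : (lift g₁ E.⋆ E.∂ (m , p) (lift g₂)) w ≡ k *q (weight w *q B)
    from-right = trans (E.⋆-cong (λ _ → refl) (∂-lift m p g₂) w)
      (trans (E.⋆-scaleʳ k (lift g₁) (lift (H.∂ m g₂)) w)
             (cong (k *q_) (sym (lift-⋆-at w g₁ (H.∂ m g₂)))))

  lift-⋆ : ∀ g₁ g₂ → lift (g₁ H.⋆ g₂) ≗ lift g₁ E.⋆ lift g₂
  lift-⋆ g₁ g₂ w = lift-⋆-at w g₁ g₂

  restrictᴱ : E2.Elem → H1.Elem
  restrictᴱ = map (λ (c , w) →
    (2^ length w *q (𝟙 (w E2.≟W embed (underlying w)) *q c) , underlying w))

  𝟙-even-*-δ : ∀ w h → 𝟙 (w E2.≟W embed (underlying w)) *q H.δ (underlying w) h ≡ E.δ w (embed h)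
  𝟙-even-*-δ w h = trans (𝟙-× (w E2.≟W embed (underlying w)) (underlying w H1.≟W h))
    (𝟙-⇔ (λ (w-even , w↦h) → trans w-even (cong embed w↦h))
         (λ w≡h → trans w≡h (cong embed (sym (trans (cong underlying w≡h) (underlying∘embed h))))
                , trans (cong underlying w≡h) (underlying∘embed h))
         ((w E2.≟W embed (underlying w)) ×-dec (underlying w H1.≟W h)) (w E2.≟W embed h))

  2^length-*-δ-embed : ∀ w h → 2^ length w *q E.δ w (embed h) ≡ 2^ length h *q E.δ w (embed h)
  2^length-*-δ-embed w h with w E2.≟W embed h
  ... | yes refl = cong (λ n → 2^ n *q 1ℚ) (ListP.length-map _ h)
  ... | no _     = trans (ℚP.*-zeroʳ (2^ length w)) (sym (ℚP.*-zeroʳ (2^ length h)))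

  coeff-restrictᴱ : ∀ u → H1.coeff (restrictᴱ u) ≗ restrict (E2.coeff u)
  coeff-restrictᴱ [] h = sym (ℚP.*-zeroʳ (2^ length h))
  coeff-restrictᴱ ((c , w) ∷ u) h = begin
    H1.coeff ((2^ length w *q (e *q c) , underlying w) ∷ restrictᴱ u) h
      ≡⟨ H.coeff-∷ _ (underlying w) (restrictᴱ u) h ⟩
    (2^ length w *q (e *q c)) *q H.δ (underlying w) h +q H1.coeff (restrictᴱ u) h
      ≡⟨ cong₂ _+q_ (solve 4 (λ t e c d → (t :* (e :* c)) :* d := c :* (t :* (e :* d))) refl
                             (2^ length w) e c (H.δ (underlying w) h))
                    (coeff-restrictᴱ u h) ⟩
    c *q (2^ length w *q (e *q H.δ (underlying w) h)) +q restrict (E2.coeff u) h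
      ≡⟨ cong (λ z → c *q z +q restrict (E2.coeff u) h)
              (trans (cong (2^ length w *q_) (𝟙-even-*-δ w h)) (2^length-*-δ-embed w h)) ⟩
    c *q (2^ length h *q E.δ w (embed h)) +q 2^ length h *q E2.coeff u (embed h)
      ≡⟨ solve 4 (λ c t d x → c :* (t :* d) :+ t :* x := t :* (c :* d :+ x)) refl
                 c (2^ length h) (E.δ w (embed h)) (E2.coeff u (embed h)) ⟩
    2^ length h *q (c *q E.δ w (embed h) +q E2.coeff u (embed h))
      ≡⟨ cong (2^ length h *q_) (sym (E.coeff-∷ c w u (embed h))) ⟩
    restrict (E2.coeff ((c , w) ∷ u)) h ∎
    where
    open ≡-Reasoning
    e : ℚ
    e = 𝟙 (w E2.≟W embed (underlying w))

  liftWord : H1.Word → E2.Elem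
  liftWord [] = E2.oneE
  liftWord (m ∷ v) = E2.prefix (m , false) ((½ *q χ false) E2.· liftWord v)
                E2.⊕ E2.prefix (m , true) ((½ *q χ true) E2.· liftWord v)

  𝟙-select-parity : ∀ q (f : Bool → ℚ) →
    𝟙 (false ≟𝔹 q) *q f false +q 𝟙 (true ≟𝔹 q) *q f true ≡ f q
  𝟙-select-parity false f =
    solve 2 (λ a b → con 1ℚ :* a :+ con 0ℚ :* b := a) refl (f false) (f true)
  𝟙-select-parity true f =
    solve 2 (λ a b → con 0ℚ :* a :+ con 1ℚ :* b := b) refl (f false) (f true)

  coeff-liftWord : ∀ v → E2.coeff (liftWord v) ≗ lift (H.δ v)
  coeff-liftWord [] [] = refl
  coeff-liftWord [] (a ∷ w) = sym (ℚP.*-zeroʳ (weight (a ∷ w)))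
  coeff-liftWord (m ∷ v) [] =
    trans (E.coeff-⊕ (E2.prefix (m , false) (half false)) (E2.prefix (m , true) (half true)) [])
          (cong₂ _+q_ (E.coeff-prefix-[] (m , false) (half false))
                      (E.coeff-prefix-[] (m , true) (half true)))
    where
    half : Bool → E2.Elem
    half b = (½ *q χ b) E2.· liftWord v
  coeff-liftWord (m ∷ v) ((n , q) ∷ w) = begin
    E2.coeff (E2.prefix (m , false) (c false E2.· liftWord v)
              E2.⊕ E2.prefix (m , true) (c true E2.· liftWord v)) ((n , q) ∷ w)
      ≡⟨ E.coeff-⊕ (E2.prefix (m , false) (c false E2.· liftWord v))
                   (E2.prefix (m , true) (c true E2.· liftWord v)) ((n , q) ∷ w) ⟩
    E2.coeff (E2.prefix (m , false) (c false E2.· liftWord v)) ((n , q) ∷ w)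
      +q E2.coeff (E2.prefix (m , true) (c true E2.· liftWord v)) ((n , q) ∷ w)
      ≡⟨ cong₂ _+q_ (from-parity false) (from-parity true) ⟩
    (i *q 𝟙 (false ≟𝔹 q)) *q (c false *q x) +q (i *q 𝟙 (true ≟𝔹 q)) *q (c true *q x)
      ≡⟨ solve 5 (λ i a b y z → (i :* a) :* y :+ (i :* b) :* z := i :* (a :* y :+ b :* z)) refl
                 i (𝟙 (false ≟𝔹 q)) (𝟙 (true ≟𝔹 q)) (c false *q x) (c true *q x) ⟩
    i *q (𝟙 (false ≟𝔹 q) *q (c false *q x) +q 𝟙 (true ≟𝔹 q) *q (c true *q x))
      ≡⟨ cong (i *q_) (𝟙-select-parity q (λ b → c b *q x)) ⟩
    i *q (c q *q (weight w *q H.δ v (underlying w)))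
      ≡⟨ solve 4 (λ i c t d → i :* (c :* (t :* d)) := (c :* t) :* (i :* d)) refl
                 i (c q) (weight w) (H.δ v (underlying w)) ⟩
    (c q *q weight w) *q (i *q H.δ v (underlying w))
      ≡⟨ cong ((c q *q weight w) *q_) (sym (H.δ-∷ m v n (underlying w))) ⟩
    lift (H.δ (m ∷ v)) ((n , q) ∷ w) ∎
    where
    open ≡-Reasoning
    c : Bool → ℚ
    c b = ½ *q χ b
    i x : ℚ
    i = 𝟙 (m ≟ℕ n)
    x = weight w *q H.δ v (underlying w)
    from-parity : ∀ b → E2.coeff (E2.prefix (m , b) (c b E2.· liftWord v)) ((n , q) ∷ w)
                        ≡ (i *q 𝟙 (b ≟𝔹 q)) *q (c b *q x)
    from-parity b = trans (E.coeff-prefix-∷ (m , b) (c b E2.· liftWord v) (n , q) w)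
      (cong₂ _*q_ (𝟙-≟LE m b n q)
                  (trans (E.coeff-· (c b) (liftWord v) w) (cong (c b *q_) (coeff-liftWord v w))))

  liftᴱ : H1.Elem → E2.Elem
  liftᴱ [] = []
  liftᴱ ((c , v) ∷ h) = (c E2.· liftWord v) E2.⊕ liftᴱ h

  coeff-liftᴱ : ∀ h → E2.coeff (liftᴱ h) ≗ lift (H1.coeff h)
  coeff-liftᴱ [] w = sym (ℚP.*-zeroʳ (weight w))
  coeff-liftᴱ ((c , v) ∷ h) w = begin
    E2.coeff ((c E2.· liftWord v) E2.⊕ liftᴱ h) w
      ≡⟨ E.coeff-⊕ (c E2.· liftWord v) (liftᴱ h) w ⟩
    E2.coeff (c E2.· liftWord v) w +q E2.coeff (liftᴱ h) w
      ≡⟨ cong₂ _+q_ (trans (E.coeff-· c (liftWord v) w) (cong (c *q_) (coeff-liftWord v w)))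
                    (coeff-liftᴱ h w) ⟩
    c *q (weight w *q d) +q weight w *q H1.coeff h (underlying w)
      ≡⟨ solve 4 (λ c t d y → c :* (t :* d) :+ t :* y := t :* (c :* d :+ y)) refl
                 c (weight w) d (H1.coeff h (underlying w)) ⟩
    weight w *q (c *q d +q H1.coeff h (underlying w))
      ≡⟨ cong (weight w *q_) (sym (H.coeff-∷ c v h (underlying w))) ⟩
    lift (H1.coeff ((c , v) ∷ h)) w ∎
    where
    open ≡-Reasoning
    d : ℚ
    d = H.δ v (underlying w)

  lift-image⇒invariant : ∀ u g → E2.coeff u ≗ lift g → Invariant u
  lift-image⇒invariant u g u≗ w =
    trans (u≗ w) (trans (lift-invariant g w) (cong (χʷ w *q_) (sym (u≗ (forgetParity w)))))

  coeff-*-invariant : ∀ u v → Invariant u → Invariant v →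
    E2.coeff (u E2.* v) ≗ lift (restrict (E2.coeff u) H.⋆ restrict (E2.coeff v))
  coeff-*-invariant u v inv-u inv-v w = trans (E.coeff-* u v w)
    (trans (E.⋆-cong (invariant⇒lift∘restrict u inv-u) (invariant⇒lift∘restrict v inv-v) w)
           (sym (lift-⋆ (restrict (E2.coeff u)) (restrict (E2.coeff v)) w)))

  invariant-subalgebra : IsSubalgebra Invariant
  invariant-subalgebra = record
    { respects = λ u v u≈v inv-u w →
        trans (sym (u≈v w)) (trans (inv-u w) (cong (χʷ w *q_) (u≈v (forgetParity w))))
    ; zero-mem = λ w → sym (ℚP.*-zeroʳ (χʷ w))
    ; add-mem = λ u v inv-u inv-v w → trans (E.coeff-⊕ u v w)
        (trans (cong₂ _+q_ (inv-u w) (inv-v w))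
        (trans (sym (ℚP.*-distribˡ-+ (χʷ w) _ _))
               (cong (χʷ w *q_) (sym (E.coeff-⊕ u v (forgetParity w))))))
    ; smul-mem = λ c u inv-u w → trans (E.coeff-· c u w)
        (trans (cong (c *q_) (inv-u w))
        (trans (x∙yz≈y∙xz c (χʷ w) (E2.coeff u (forgetParity w)))
               (cong (χʷ w *q_) (sym (E.coeff-· c u (forgetParity w))))))
    ; one-mem = lift-image⇒invariant E2.oneE (H.δ []) (coeff-liftWord [])
    ; mul-mem = λ u v inv-u inv-v →
        lift-image⇒invariant (u E2.* v) (restrict (E2.coeff u) H.⋆ restrict (E2.coeff v))
                             (coeff-*-invariant u v inv-u inv-v)
    }

  restrictᴱ-cong : ∀ u f → E2.coeff u ≗ f → H1.coeff (restrictᴱ u) ≗ restrict f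
  restrictᴱ-cong u f u≗f h = trans (coeff-restrictᴱ u h) (cong (2^ length h *q_) (u≗f (embed h)))

  restrictᴱ-⊕ : ∀ u v z → z E2.≈ (u E2.⊕ v) → restrictᴱ z H1.≈ (restrictᴱ u H1.⊕ restrictᴱ v)
  restrictᴱ-⊕ u v z z≈ h = begin
    H1.coeff (restrictᴱ z) h
      ≡⟨ restrictᴱ-cong z (E2.coeff u E.+ᶠ E2.coeff v) (λ w → trans (z≈ w) (E.coeff-⊕ u v w)) h ⟩
    2^ length h *q (E2.coeff u (embed h) +q E2.coeff v (embed h))
      ≡⟨ ℚP.*-distribˡ-+ (2^ length h) _ _ ⟩
    restrict (E2.coeff u) h +q restrict (E2.coeff v) h
      ≡⟨ sym (cong₂ _+q_ (coeff-restrictᴱ u h) (coeff-restrictᴱ v h)) ⟩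
    H1.coeff (restrictᴱ u) h +q H1.coeff (restrictᴱ v) h
      ≡⟨ sym (H.coeff-⊕ (restrictᴱ u) (restrictᴱ v) h) ⟩
    H1.coeff (restrictᴱ u H1.⊕ restrictᴱ v) h ∎
    where open ≡-Reasoning

  restrictᴱ-· : ∀ c u z → z E2.≈ (c E2.· u) → restrictᴱ z H1.≈ (c H1.· restrictᴱ u)
  restrictᴱ-· c u z z≈ h = begin
    H1.coeff (restrictᴱ z) h
      ≡⟨ restrictᴱ-cong z (c E.·ᶠ E2.coeff u) (λ w → trans (z≈ w) (E.coeff-· c u w)) h ⟩
    2^ length h *q (c *q E2.coeff u (embed h))
      ≡⟨ x∙yz≈y∙xz (2^ length h) c (E2.coeff u (embed h)) ⟩
    c *q restrict (E2.coeff u) h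
      ≡⟨ cong (c *q_) (sym (coeff-restrictᴱ u h)) ⟩
    c *q H1.coeff (restrictᴱ u) h
      ≡⟨ sym (H.coeff-· c (restrictᴱ u) h) ⟩
    H1.coeff (c H1.· restrictᴱ u) h ∎
    where open ≡-Reasoning

  restrictᴱ-one : ∀ z → z E2.≈ E2.oneE → restrictᴱ z H1.≈ H1.oneE
  restrictᴱ-one z z≈ [] = restrictᴱ-cong z (E2.coeff E2.oneE) z≈ []
  restrictᴱ-one z z≈ (n ∷ h) =
    trans (restrictᴱ-cong z (E2.coeff E2.oneE) z≈ (n ∷ h)) (ℚP.*-zeroʳ (2^ length (n ∷ h)))

  restrictᴱ-* : ∀ u v z → Invariant u → Invariant v → z E2.≈ (u E2.* v) →
                restrictᴱ z H1.≈ (restrictᴱ u H1.* restrictᴱ v)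
  restrictᴱ-* u v z inv-u inv-v z≈ h = begin
    H1.coeff (restrictᴱ z) h
      ≡⟨ restrictᴱ-cong z (lift (restrict (E2.coeff u) H.⋆ restrict (E2.coeff v)))
                        (λ w → trans (z≈ w) (coeff-*-invariant u v inv-u inv-v w)) h ⟩
    restrict (lift (restrict (E2.coeff u) H.⋆ restrict (E2.coeff v))) h
      ≡⟨ restrict∘lift (restrict (E2.coeff u) H.⋆ restrict (E2.coeff v)) h ⟩
    (restrict (E2.coeff u) H.⋆ restrict (E2.coeff v)) h
      ≡⟨ H.⋆-cong (λ h′ → sym (coeff-restrictᴱ u h′)) (λ h′ → sym (coeff-restrictᴱ v h′)) h ⟩
    (H1.coeff (restrictᴱ u) H.⋆ H1.coeff (restrictᴱ v)) h
      ≡⟨ sym (H.coeff-* (restrictᴱ u) (restrictᴱ v) h) ⟩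
    H1.coeff (restrictᴱ u H1.* restrictᴱ v) h ∎
    where open ≡-Reasoning

  restrictᴱ-injective : ∀ u v → Invariant u → Invariant v →
                        restrictᴱ u H1.≈ restrictᴱ v → u E2.≈ v
  restrictᴱ-injective u v inv-u inv-v u≈v w = begin
    E2.coeff u w                                      ≡⟨ invariant⇒lift∘restrict u inv-u w ⟩
    weight w *q restrict (E2.coeff u) (underlying w)  ≡⟨ cong (weight w *q_) same-restriction ⟩
    weight w *q restrict (E2.coeff v) (underlying w)  ≡⟨ sym (invariant⇒lift∘restrict v inv-v w) ⟩
    E2.coeff v w                                      ∎
    where
    open ≡-Reasoning
    same-restriction : restrict (E2.coeff u) (underlying w) ≡ restrict (E2.coeff v) (underlying w)
    same-restriction = trans (sym (coeff-restrictᴱ u (underlying w)))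
      (trans (u≈v (underlying w)) (coeff-restrictᴱ v (underlying w)))

  liftᴱ-invariant : ∀ h → Invariant (liftᴱ h)
  liftᴱ-invariant h = lift-image⇒invariant (liftᴱ h) (H1.coeff h) (coeff-liftᴱ h)

  restrictᴱ∘liftᴱ : ∀ h → restrictᴱ (liftᴱ h) H1.≈ h
  restrictᴱ∘liftᴱ h h′ =
    trans (restrictᴱ-cong (liftᴱ h) (lift (H1.coeff h)) (coeff-liftᴱ h) h′)
          (restrict∘lift (H1.coeff h) h′)

  restrictᴱ-iso : AlgebraIso Invariant
  restrictᴱ-iso = record
    { φ      = λ (u , _) → restrictᴱ u
    ; φ-wd   = λ (u , _) (v , _) u≈v h →
                 trans (restrictᴱ-cong u (E2.coeff v) u≈v h) (sym (coeff-restrictᴱ v h))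
    ; φ-add  = λ (u , _) (v , _) (z , _) → restrictᴱ-⊕ u v z
    ; φ-smul = λ c (u , _) (z , _) → restrictᴱ-· c u z
    ; φ-one  = λ (z , _) → restrictᴱ-one z
    ; φ-mul  = λ (u , inv-u) (v , inv-v) (z , _) → restrictᴱ-* u v z inv-u inv-v
    ; φ-inj  = λ (u , inv-u) (v , inv-v) → restrictᴱ-injective u v inv-u inv-v
    ; φ-surj = λ h → (liftᴱ h , liftᴱ-invariant h) , restrictᴱ∘liftᴱ h
    }

module _ {P Q : E2.Elem → Set} (P⇒Q : ∀ u → P u → Q u) (Q⇒P : ∀ u → Q u → P u) where

  IsSubalgebra-⇔ : IsSubalgebra P → IsSubalgebra Q
  IsSubalgebra-⇔ sub = record
    { respects = λ u v u≈v q → P⇒Q v (respects u v u≈v (Q⇒P u q))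
    ; zero-mem = P⇒Q _ zero-mem
    ; add-mem  = λ u v qu qv → P⇒Q _ (add-mem u v (Q⇒P u qu) (Q⇒P v qv))
    ; smul-mem = λ c u qu → P⇒Q _ (smul-mem c u (Q⇒P u qu))
    ; one-mem  = P⇒Q _ one-mem
    ; mul-mem  = λ u v qu qv → P⇒Q _ (mul-mem u v (Q⇒P u qu) (Q⇒P v qv))
    }
    where open IsSubalgebra sub

  AlgebraIso-⇔ : AlgebraIso P → AlgebraIso Q
  AlgebraIso-⇔ iso = record
    { φ      = λ x → φ (toP x)
    ; φ-wd   = λ x y → φ-wd (toP x) (toP y)
    ; φ-add  = λ x y z → φ-add (toP x) (toP y) (toP z)
    ; φ-smul = λ c x z → φ-smul c (toP x) (toP z)
    ; φ-one  = λ x → φ-one (toP x)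
    ; φ-mul  = λ x y z → φ-mul (toP x) (toP y) (toP z)
    ; φ-inj  = λ x y → φ-inj (toP x) (toP y)
    ; φ-surj = λ h → let ((u , pu) , φu≈h) = φ-surj h in
        (u , P⇒Q u pu) , λ h′ → trans (φ-wd _ (u , pu) (λ _ → refl) h′) (φu≈h h′)
    }
    where
    open AlgebraIso iso
    toP : Σ E2.Elem Q → Σ E2.Elem P
    toP (u , qu) = u , Q⇒P u qu

χ-sym : Bool → ℚ
χ-sym _ = 1ℚ

χ-anti : Bool → ℚ
χ-anti false = 1ℚ
χ-anti true  = - 1ℚ

χ-anti-true : ∀ p → χ-anti true *q χ-anti (not p) ≡ χ-anti p
χ-anti-true false = refl
χ-anti-true true  = refl

module Sym  = Twisted χ-sym refl (λ _ → refl)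
module Anti = Twisted χ-anti refl χ-anti-true

χʷ-sym : ∀ w → Sym.χʷ w ≡ 1ℚ
χʷ-sym [] = refl
χʷ-sym ((m , p) ∷ w) = cong (1ℚ *q_) (χʷ-sym w)

χʷ-anti : ∀ w → Anti.χʷ w ≡ sign w
χʷ-anti [] = refl
χʷ-anti ((m , false) ∷ w) = trans (ℚP.*-identityˡ _) (χʷ-anti w)
χʷ-anti ((m , true) ∷ w) =
  trans (sym (ℚP.neg-distribˡ-* 1ℚ (Anti.χʷ w))) (cong -_ (trans (ℚP.*-identityˡ _) (χʷ-anti w)))

Sym-Invariant⇒TotallySymmetric : ∀ u → Sym.Invariant u → TotallySymmetric u
Sym-Invariant⇒TotallySymmetric u inv w = trans (inv w)
  (trans (cong (_*q E2.coeff u (forgetParity w)) (χʷ-sym w)) (ℚP.*-identityˡ _))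

TotallySymmetric⇒Sym-Invariant : ∀ u → TotallySymmetric u → Sym.Invariant u
TotallySymmetric⇒Sym-Invariant u sym-u w = trans (sym-u w)
  (sym (trans (cong (_*q E2.coeff u (forgetParity w)) (χʷ-sym w)) (ℚP.*-identityˡ _)))

Anti-Invariant⇒TotallyAntisymmetric : ∀ u → Anti.Invariant u → TotallyAntisymmetric u
Anti-Invariant⇒TotallyAntisymmetric u inv w =
  trans (inv w) (cong (_*q E2.coeff u (forgetParity w)) (χʷ-anti w))

TotallyAntisymmetric⇒Anti-Invariant : ∀ u → TotallyAntisymmetric u → Anti.Invariant u
TotallyAntisymmetric⇒Anti-Invariant u anti-u w =
  trans (anti-u w) (cong (_*q E2.coeff u (forgetParity w)) (sym (χʷ-anti w)))

theorem3p1 : (IsSubalgebra TotallySymmetric × AlgebraIso TotallySymmetric)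
    × (IsSubalgebra TotallyAntisymmetric × AlgebraIso TotallyAntisymmetric)
theorem3p1 =
  ( IsSubalgebra-⇔ Sym-Invariant⇒TotallySymmetric TotallySymmetric⇒Sym-Invariant
                   Sym.invariant-subalgebra
  , AlgebraIso-⇔ Sym-Invariant⇒TotallySymmetric TotallySymmetric⇒Sym-Invariant
                 Sym.restrictᴱ-iso )
  , ( IsSubalgebra-⇔ Anti-Invariant⇒TotallyAntisymmetric TotallyAntisymmetric⇒Anti-Invariant
                     Anti.invariant-subalgebra
    , AlgebraIso-⇔ Anti-Invariant⇒TotallyAntisymmetric TotallyAntisymmetric⇒Anti-Invariant
                   Anti.restrictᴱ-iso )
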